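{- Let $n$ be a positive integer and let $r,s$ be integers with $r \geq s \geq 2$. Then there is no hypergraph $\mathcal{H}$ with vertex set $[n]$ such that simultaneously $\chi\left(\mathrm{KG}^r(\mathcal{H}_{s\text{ -stable}})\right) = 0$ and $\left\lceil \frac{\mathrm{cd}^r(\mathcal{H})}{r-1} \right\rceil \geq 2$.
   Context: $[n]=\{1,\dots,n\}$. A hypergraph $\mathcal{H}$ on vertex set $V$ is a family $E(\mathcal{H})$ of nonempty subsets of $V$ (hyperedges); a graph is a hypergraph all of whose hyperedges have size 2. A set $S \subseteq [n]$ is $s$-stable if any two distinct $i,j \in S$ satisfy $s \leq |i-j| \leq n-s$. For a hypergraph $\mathcal{H}$ on $[n]$, $\mathcal{H}_{s\text{ -stable}}$ denotes the hypergraph on $[n]$ whose hyperedges are the $s$-stable hyperedges of $\mathcal{H}$. For a hypergraph $\mathcal{F}$ and $r\ge 2$, the general Kneser hypergraph $\mathrm{KG}^r(\mathcal{F})$ has vertex set $E(\mathcal{F})$, and its hyperedges are the sets of $r$ pairwise disjoint hyperedges of $\mathcal{F}$. The chromatic number $\chi$ of a hypergraph is the least number of colors in a vertex coloring with no monochromatic hyperedge (it is $0$ when the vertex set is empty). The $r$-colorability defect $\mathrm{cd}^r(\mathcal{H})$ is the minimum size of a set $S \subseteq V(\mathcal{H})$ such that the induced subhypergraph on $V(\mathcal{H})\setminus S$ (whose hyperedges are the hyperedges of $\mathcal{H}$ contained in $V(\mathcal{H})\setminus S$) admits a vertex coloring with at most $r$ colors having no monochromatic hyperedge. -}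

module Defs where

open import Level using (0ℓ)
open import Data.Nat using (ℕ; zero; suc; _+_; _∸_; _≤_; ∣_-_∣; _/_)
open import Data.Fin using (Fin; toℕ)
open import Data.Fin.Subset using (Subset; _∈_; _∩_; _⊆_; ∁; ∣_∣; Nonempty; Empty)
open import Data.Product using (Σ; _×_; ∃; proj₁)
open import Relation.Nullary using (¬_)
open import Relation.Binary.PropositionalEquality using (_≡_; _≢_)

record Hypergraph (n : ℕ) : Set₁ where
  field
    Edge     : Subset n → Set
    nonempty : ∀ {e} → Edge e → Nonempty e
open Hypergraph public

Stable : {n : ℕ} → ℕ → Subset n → Set
Stable {n} s S = ∀ (i j : Fin n) → i ∈ S → j ∈ S → i ≢ j →
  (s ≤ ∣ toℕ i - toℕ j ∣) × (∣ toℕ i - toℕ j ∣ ≤ n ∸ s)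

stablePart : {n : ℕ} → ℕ → Hypergraph n → Hypergraph n
stablePart s H = record
  { Edge     = λ e → Edge H e × Stable s e
  ; nonempty = λ p → nonempty H (proj₁ p) }

KGVertex : {n : ℕ} → Hypergraph n → Set
KGVertex {n} F = Σ (Subset n) (Edge F)

-- Hyperedges of KG^r(F): sets of r pairwise disjoint hyperedges of F,
-- given by an enumeration f : Fin r → E(F) with pairwise disjoint values
-- (pairwise disjoint nonempty sets are automatically distinct).
PairwiseDisjoint : {n r : ℕ} {F : Hypergraph n} → (Fin r → KGVertex F) → Set
PairwiseDisjoint {n} {r} f = ∀ (i j : Fin r) → i ≢ j → Empty {n} (proj₁ (f i) ∩ proj₁ (f j))

KGProperColoring : {n : ℕ} (r : ℕ) (F : Hypergraph n) (k : ℕ) → (KGVertex F → Fin k) → Set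
KGProperColoring r F k c = ∀ (f : Fin r → KGVertex F) → PairwiseDisjoint {F = F} f →
  ¬ (∃ λ (col : Fin k) → ∀ i → c (f i) ≡ col)

KGColorable : {n : ℕ} (r : ℕ) (F : Hypergraph n) (k : ℕ) → Set
KGColorable r F k = Σ (KGVertex F → Fin k) (KGProperColoring r F k)

IsChromaticNumberKG : {n : ℕ} (r : ℕ) (F : Hypergraph n) (k : ℕ) → Set
IsChromaticNumberKG r F k = KGColorable r F k × (∀ j → KGColorable r F j → k ≤ j)

-- The induced subhypergraph of H on [n] \ S admits a proper coloring with
-- at most r colors (colors of vertices in S are irrelevant).
InducedColorable : {n : ℕ} (r : ℕ) (H : Hypergraph n) (S : Subset n) → Set
InducedColorable {n} r H S = Σ (Fin n → Fin r) λ c →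
  ∀ e → Edge H e → e ⊆ ∁ S → ¬ (∃ λ (col : Fin r) → ∀ v → v ∈ e → c v ≡ col)

IsColorabilityDefect : {n : ℕ} (r : ℕ) (H : Hypergraph n) (m : ℕ) → Set
IsColorabilityDefect r H m =
  (∃ λ S → ∣ S ∣ ≡ m × InducedColorable r H S) ×
  (∀ S → InducedColorable r H S → m ≤ ∣ S ∣)

-- Ceiling division ⌈ m / d ⌉ (d = 0 gives 0; only used with d ≥ 1).
ceilDiv : ℕ → ℕ → ℕ
ceilDiv m zero    = 0
ceilDiv m (suc k) = (m + k) / suc k

{-# OPTIONS --safe #-}
module Submission where

-- If χ(KG^r(H_{s-stable})) = 0 then H has no s-stable hyperedge at all. Write n = q r + t with
-- t < r, delete the t vertices ≥ q r and colour each remaining vertex by its residue mod r.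
-- A monochromatic hyperedge then lies in one residue class of [0, q r), so any two of its
-- vertices differ by a nonzero multiple of r that is at most (q - 1) r ≤ n - r; it is r-stable,
-- hence s-stable, which is impossible. So cd^r(H) ≤ t ≤ r - 1 and ⌈cd^r(H) / (r - 1)⌉ ≤ 1.

open import Defs
open import Data.Nat using (ℕ; zero; suc; _+_; _*_; _∸_; _≤_; _<_; z≤n; s≤s; ∣_-_∣; _/_; _%_; NonZero; >-nonZero)
open import Data.Nat.Properties
open import Data.Nat.DivMod using (m≡m%n+[m/n]*n; m%n≡m∸m/n*n; m%n<n; m/n*n≤m; m<n*o⇒m/o<n)
open import Data.Fin using (Fin; toℕ; fromℕ<) renaming (zero to fzero; suc to fsuc)
open import Data.Fin.Properties using (toℕ-fromℕ<; toℕ-injective)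
open import Data.Fin.Subset using (Subset; _∈_; _∉_; _⊆_; ∁; ⊤; outside; ∣_∣)
open import Data.Fin.Subset.Properties using (∈⊤; ∣⊤∣≡n; x∈∁p⇒x∉p)
open import Data.Vec using ([]; _∷_; there)
open import Data.Product using (Σ; _×_; _,_)
open import Data.Empty using (⊥-elim)
open import Relation.Nullary using (¬_)
open import Relation.Binary.PropositionalEquality using (_≡_; _≢_; refl; sym; trans; cong; cong₂; subst; module ≡-Reasoning)

KGColorable-0⇒edgeless : ∀ {n r} {F : Hypergraph n} → KGColorable r F 0 → ∀ e → ¬ Edge F e
KGColorable-0⇒edgeless (c , _) e e∈F with c (e , e∈F)
... | ()

Stable-anti : ∀ {n s t} {e : Subset n} → s ≤ t → Stable t e → Stable s e
Stable-anti s≤t stable i j i∈e j∈e i≢j =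
  let t≤∣i-j∣ , ∣i-j∣≤n∸t = stable i j i∈e j∈e i≢j
  in ≤-trans s≤t t≤∣i-j∣ , ≤-trans ∣i-j∣≤n∸t (∸-monoʳ-≤ _ s≤t)

atLeast : (n k : ℕ) → Subset n
atLeast n       zero    = ⊤
atLeast zero    (suc k) = []
atLeast (suc n) (suc k) = outside ∷ atLeast n k

∣atLeast∣ : ∀ n k → ∣ atLeast n k ∣ ≡ n ∸ k
∣atLeast∣ n       zero    = ∣⊤∣≡n n
∣atLeast∣ zero    (suc k) = refl
∣atLeast∣ (suc n) (suc k) = ∣atLeast∣ n k

∉atLeast⇒< : ∀ {n} k (v : Fin n) → v ∉ atLeast n k → toℕ v < k
∉atLeast⇒< zero    v        v∉ = ⊥-elim (v∉ ∈⊤)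
∉atLeast⇒< (suc k) fzero    v∉ = s≤s z≤n
∉atLeast⇒< (suc k) (fsuc v) v∉ = s≤s (∉atLeast⇒< k v (λ v∈ → v∉ (there v∈)))

module _ (d : ℕ) .{{_ : NonZero d}} where

  ∣-∣-≡-mod : ∀ a b → a % d ≡ b % d → ∣ a - b ∣ ≡ ∣ a / d - b / d ∣ * d
  ∣-∣-≡-mod a b a≡b = begin
    ∣ a - b ∣                                       ≡⟨ cong₂ ∣_-_∣ (m≡m%n+[m/n]*n a d) (m≡m%n+[m/n]*n b d) ⟩
    ∣ a % d + a / d * d - b % d + b / d * d ∣       ≡⟨ cong (λ x → ∣ a % d + a / d * d - x + b / d * d ∣) (sym a≡b) ⟩
    ∣ a % d + a / d * d - a % d + b / d * d ∣       ≡⟨ ∣m+n-m+o∣≡∣n-o∣ (a % d) _ _ ⟩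
    ∣ a / d * d - b / d * d ∣                       ≡⟨ sym (*-distribʳ-∣-∣ d (a / d) (b / d)) ⟩
    ∣ a / d - b / d ∣ * d                           ∎
    where open ≡-Reasoning

  ≡-mod-distance : ∀ q a b → a % d ≡ b % d → a ≢ b → a < q * d → b < q * d →
                   d ≤ ∣ a - b ∣ × ∣ a - b ∣ ≤ q * d ∸ d
  ≡-mod-distance q a b a≡b a≢b a<qd b<qd = lower , upper
    where
    open ≤-Reasoning
    k = ∣ a / d - b / d ∣
    distance : ∣ a - b ∣ ≡ k * d
    distance = ∣-∣-≡-mod a b a≡b
    k≢0 : k ≢ 0
    k≢0 k≡0 = a≢b (∣m-n∣≡0⇒m≡n (trans distance (cong (_* d) k≡0)))
    lower : d ≤ ∣ a - b ∣
    lower = begin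
      d      ≡⟨ sym (*-identityˡ d) ⟩
      1 * d  ≤⟨ *-monoˡ-≤ d (n≢0⇒n>0 k≢0) ⟩
      k * d  ≡⟨ sym distance ⟩
      ∣ a - b ∣ ∎
    quotient<q : ∀ x → x < q * d → x / d ≤ q ∸ 1
    quotient<q x x<qd = ∸-monoˡ-≤ 1 (m<n*o⇒m/o<n {n = q} x<qd)
    upper : ∣ a - b ∣ ≤ q * d ∸ d
    upper = begin
      ∣ a - b ∣        ≡⟨ distance ⟩
      k * d            ≤⟨ *-monoˡ-≤ d (≤-trans (∣m-n∣≤m⊔n (a / d) (b / d)) (⊔-lub (quotient<q a a<qd) (quotient<q b b<qd))) ⟩
      (q ∸ 1) * d      ≡⟨ *-distribʳ-∸ d q 1 ⟩
      q * d ∸ 1 * d    ≡⟨ cong (q * d ∸_) (*-identityˡ d) ⟩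
      q * d ∸ d        ∎

  residue : ∀ {n} → Fin n → Fin d
  residue v = fromℕ< (m%n<n (toℕ v) d)

  residue-≡ : ∀ {n} (u v : Fin n) → residue u ≡ residue v → toℕ u % d ≡ toℕ v % d
  residue-≡ u v eq = trans (sym (toℕ-fromℕ< _)) (trans (cong toℕ eq) (toℕ-fromℕ< _))

  residueClass-stable : ∀ {n} (e : Subset n) → (∀ {v} → v ∈ e → toℕ v < n / d * d) →
                        (∀ {u v} → u ∈ e → v ∈ e → residue u ≡ residue v) → Stable d e
  residueClass-stable {n} e below sameResidue i j i∈e j∈e i≢j =
    let d≤∣i-j∣ , ∣i-j∣≤qd∸d = ≡-mod-distance (n / d) (toℕ i) (toℕ j)
          (residue-≡ i j (sameResidue i∈e j∈e)) (λ eq → i≢j (toℕ-injective eq)) (below i∈e) (below j∈e)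
    in d≤∣i-j∣ , ≤-trans ∣i-j∣≤qd∸d (∸-monoˡ-≤ d (m/n*n≤m n d))

  ∣atLeast[n/d*d]∣<d : ∀ n → ∣ atLeast n (n / d * d) ∣ < d
  ∣atLeast[n/d*d]∣<d n = subst (_< d) (trans (m%n≡m∸m/n*n n d) (sym (∣atLeast∣ n (n / d * d)))) (m%n<n n d)

  residueColoring : ∀ {n s} (H : Hypergraph n) → s ≤ d → (∀ e → Edge H e → ¬ Stable s e) →
                    InducedColorable d H (atLeast n (n / d * d))
  residueColoring {n} H s≤d noStable = residue , monochromatic⇒stable
    where
    monochromatic⇒stable : ∀ e → Edge H e → e ⊆ ∁ (atLeast n (n / d * d)) →
                           ¬ Σ (Fin d) λ c → ∀ v → v ∈ e → residue v ≡ c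
    monochromatic⇒stable e e∈H e⊆ (c , mono) = noStable e e∈H (Stable-anti s≤d (residueClass-stable e
      (λ {v} v∈e → ∉atLeast⇒< (n / d * d) v (x∈∁p⇒x∉p (e⊆ v∈e)))
      (λ {u} {v} u∈e v∈e → trans (mono u u∈e) (sym (mono v v∈e)))))

ceilDiv[m,r∸1]≤1 : ∀ {m r} → 2 ≤ r → m < r → ceilDiv m (r ∸ 1) ≤ 1
ceilDiv[m,r∸1]≤1 {m} {suc (suc k)} (s≤s (s≤s _)) (s≤s m≤suc[k]) = <⇒≤pred (m<n*o⇒m/o<n m+k<2[k+1])
  where
  m+k<2[k+1] : m + k < 2 * suc k
  m+k<2[k+1] = begin-strict
    m + k          ≤⟨ +-monoˡ-≤ k m≤suc[k] ⟩
    suc k + k      <⟨ +-monoʳ-< (suc k) (n<1+n k) ⟩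
    suc k + suc k  ≡⟨ cong (suc k +_) (sym (+-identityʳ (suc k))) ⟩
    2 * suc k      ∎
    where open ≤-Reasoning

theorem1p9 : (n r s : ℕ) → 1 ≤ n → 2 ≤ s → s ≤ r →
    ¬ (Σ (Hypergraph n) λ H →
         IsChromaticNumberKG r (stablePart s H) 0 ×
         Σ ℕ λ m → IsColorabilityDefect r H m × 2 ≤ ceilDiv m (r ∸ 1))
theorem1p9 n r s _ 2≤s s≤r (H , (χ≡0 , _) , m , (_ , minimal) , 2≤ceil) =
  <⇒≱ (s≤s (ceilDiv[m,r∸1]≤1 2≤r m<r)) 2≤ceil
  where
  2≤r : 2 ≤ r
  2≤r = ≤-trans 2≤s s≤r
  instance
    r≢0 : NonZero r
    r≢0 = >-nonZero (≤-trans (s≤s z≤n) 2≤r)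
  noStable : ∀ e → Edge H e → ¬ Stable s e
  noStable e e∈H stable = KGColorable-0⇒edgeless {r = r} {F = stablePart s H} χ≡0 e (e∈H , stable)
  m<r : m < r
  m<r = ≤-<-trans (minimal _ (residueColoring r H s≤r noStable)) (∣atLeast[n/d*d]∣<d r n)
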